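{- Let $\lambda=(\lambda_1\le\cdots\le\lambda_n)$ be a partition with $\lambda_i\ge i$ for all $i$ and $\lambda_n=n+1$, and let $\lambda'$ be its conjugate. Then the rook posets $P_\lambda$ and $P_{\lambda'}$ are isomorphic. An isomorphism is obtained as follows: extend a maximal rook placement $x$ on $\lambda$ to a maximal rook placement on $(\lambda_1,\dots,\lambda_n,n+1)$ in the only possible way (the rook in row $n+1$ goes in the unique column of $\{1,\dots,n+1\}$ not used by $x$), apply the reflection $(i,j)\mapsto(n+2-j,\,n+2-i)$ to the rooks, and remove the top row.
   Context: Ferrers board of $\lambda$: cells $(i,j)$ with row $i$ counted from the bottom, $1\le j\le\lambda_i$. A maximal rook placement is a sequence $x=(x_1,\dots,x_n)$ of distinct integers with $1\le x_i\le\lambda_i$ (rook at $(i,x_i)$). The rook poset $P_\lambda$: $x\le y$ iff for every $j$ the increasingly sorted list of $\{x_1,\dots,x_j\}$ is entrywise $\le$ that of $\{y_1,\dots,y_j\}$. Conjugate: with $\lambda_{n+1}:=n+1$, the conjugate $\lambda'=(\lambda'_1,\dots,\lambda'_n)$ is given by $\lambda'_r=\#\{i\in\{1,\dots,n+1\}:\lambda_i\ge n+2-r\}$; geometrically, add a top row of $n+1$ boxes, reflect the $(n+1)\times(n+1)$-bounded diagram across the upper-left to lower-right diagonal, and remove the top row. -}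

module Defs where

open import Data.Nat using (ℕ; zero; suc; _+_; _∸_; _≤_; _≤?_; _≟_)
open import Data.Nat.Properties using (≤-decTotalOrder)
open import Data.Fin using (Fin; toℕ)
open import Data.Vec using (Vec; lookup; tabulate; toList; _∷ʳ_)
open import Data.List using (List; []; _∷_; take; filter; length; applyUpTo; _++_; [_])
open import Data.List.Relation.Unary.Any using (any?)
open import Data.List.Relation.Binary.Pointwise using (Pointwise)
open import Data.Product using (_×_)
open import Relation.Binary.PropositionalEquality using (_≡_)
open import Relation.Nullary using (yes; no; ¬_)
open import Relation.Nullary.Decidable using (¬?)
import Data.List.Sort.InsertionSort as IS

sortℕ : List ℕ → List ℕ
sortℕ = IS.sort ≤-decTotalOrder

-- A partition λ = (λ₁ ≤ ⋯ ≤ λₙ) stored as a vector; lookup la i = λ_{toℕ i + 1}.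
WeaklyIncreasing : ∀ {n} → Vec ℕ n → Set
WeaklyIncreasing {n} la = ∀ (i j : Fin n) → toℕ i ≤ toℕ j → lookup la i ≤ lookup la j

-- Maximal rook placement on the Ferrers board of la:
-- x_i (1-indexed values) with 1 ≤ x_i ≤ λ_i, pairwise distinct.
IsRookPlacement : ∀ {n} → Vec ℕ n → Vec ℕ n → Set
IsRookPlacement {n} la x =
  (∀ (i : Fin n) → 1 ≤ lookup x i × lookup x i ≤ lookup la i) ×
  (∀ (i j : Fin n) → lookup x i ≡ lookup x j → i ≡ j)

_≤R_ : ∀ {n} → Vec ℕ n → Vec ℕ n → Set
_≤R_ {n} x y = ∀ (j : Fin (suc n)) →
  Pointwise _≤_ (sortℕ (take (toℕ j) (toList x))) (sortℕ (take (toℕ j) (toList y)))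

-- Conjugate: with λ_{n+1} := n+1, λ'_r = #{ i ∈ 1..n+1 : λ_i ≥ n+2-r }, r = 1..n.
-- (Index r : Fin n stands for r' = toℕ r + 1, so n+2-r' = n+1-toℕ r.)
conj : ∀ {n} → Vec ℕ n → Vec ℕ n
conj {n} la = tabulate λ r →
  length (filter (λ v → (n + 1 ∸ toℕ r) ≤? v) (toList (la ∷ʳ suc n)))

-- The unique column among 1..n+1 not used by x (first such; 0 if none).
missing : ∀ {n} → Vec ℕ n → ℕ
missing {n} x with filter (λ v → ¬? (any? (v ≟_) (toList x))) (applyUpTo suc (suc n))
... | [] = 0
... | v ∷ _ = v

extend : ∀ {n} → Vec ℕ n → List ℕ
extend x = toList x ++ [ missing x ]

-- 1-indexed position of the first occurrence of v in a list (0 if absent).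
posOf : ℕ → List ℕ → ℕ
posOf v [] = 0
posOf v (w ∷ ws) with v ≟ w
... | yes _ = 1
... | no _ with posOf v ws
...   | 0 = 0
...   | suc k = suc (suc k)

-- The map of the theorem: extend x, reflect each rook (i , x̂ᵢ) to
-- (n+2-x̂ᵢ , n+2-i), remove the top row (row n+1).  Row r (1..n) of the
-- result holds the rook coming from the i with x̂ᵢ = n+2-r, in column n+2-i.
φ : ∀ {n} → Vec ℕ n → Vec ℕ n
φ {n} x = tabulate λ r → (n + 2) ∸ posOf (n + 1 ∸ toℕ r) (extend x)

{-# OPTIONS --safe #-}
module Submission where

-- Every maximal rook placement x on λ is a placement on the n × (n + 1) rectangle, and
-- adding the one free column as a rook in row n + 1 turns it into a permutation x̂ of
-- {1, …, n + 1}.  The map φ reflects the graph of x̂ in the antidiagonal, so it is an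
-- involution, and the number of rooks of φ x in the first j rows and in columns ≥ k equals
-- the number of rooks of x̂ in the first n + 2 − k rows and in columns ≥ n + 2 − j.  Two
-- sorted lists compare entrywise iff, for every k, the first has at most as many entries
-- ≥ k as the second; so the rook order compares exactly these rectangle counts (those with
-- more than n rows are the same for all placements), and φ preserves and reflects it.
-- Finally λ'_r counts the rows i with λ_i ≥ n + 2 − r, and monotonicity of λ turns
-- x_i ≤ λ_i into (φ x)_r ≤ λ'_r and, dually, y_r ≤ λ'_r into (φ y)_i ≤ λ_i.

open import Defs
open import Data.Nat
open import Data.Nat.Properties
open import Data.Fin using (Fin; toℕ; fromℕ; fromℕ<)
import Data.Fin as Fin
import Data.Fin.Properties as Finₚ
open import Data.Vec using (Vec; lookup; tabulate; toList; _∷ʳ_)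
import Data.Vec as Vec
import Data.Vec.Properties as Vecₚ
open import Data.List using (List; []; _∷_; take; filter; length; applyUpTo)
import Data.List.Properties as Listₚ
open import Data.List.Relation.Unary.Any using (here; there; any?)
open import Data.List.Relation.Unary.Linked using (Linked)
import Data.List.Relation.Unary.Linked as Linked
open import Data.List.Relation.Unary.Linked.Properties using (Linked⇒All)
open import Data.List.Relation.Binary.Pointwise using (Pointwise; []; _∷_)
open import Data.List.Relation.Binary.Permutation.Propositional using (_↭_)
import Data.List.Relation.Binary.Permutation.Propositional.Properties as Permₚ
import Data.List.Sort.InsertionSort.Properties as InsertionSortₚ
open import Data.List.Membership.Propositional using (_∈_; _∉_)
open import Data.List.Membership.Propositional.Properties
  using (∈-filter⁺; ∈-filter⁻; ∈-applyUpTo⁺; ∈-applyUpTo⁻)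
open import Data.Product using (_×_; _,_; ∃; proj₁; proj₂)
open import Data.Sum using (_⊎_; inj₁; inj₂)
open import Data.Empty using (⊥-elim)
open import Relation.Nullary using (¬_; yes; no; contradiction)
open import Relation.Nullary.Decidable using (¬?)
open import Relation.Binary.PropositionalEquality
open import Function.Bundles using (_⇔_; mk⇔; Equivalence)
import Algebra.Properties.CommutativeSemigroup as CommSemigroupₚ

-- Indicators and finite sums

χ≤ : ℕ → ℕ → ℕ
χ≤ zero    _       = 1
χ≤ (suc a) zero    = 0
χ≤ (suc a) (suc b) = χ≤ a b

χ≡ : ℕ → ℕ → ℕ
χ≡ zero    zero    = 1
χ≡ zero    (suc b) = 0
χ≡ (suc a) zero    = 0
χ≡ (suc a) (suc b) = χ≡ a b

χ≤-≡1 : ∀ {a b} → a ≤ b → χ≤ a b ≡ 1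
χ≤-≡1 {zero}          _       = refl
χ≤-≡1 {suc a} {suc b} (s≤s p) = χ≤-≡1 p

χ≤-≡0 : ∀ {a b} → b < a → χ≤ a b ≡ 0
χ≤-≡0 {suc a} {zero}  _       = refl
χ≤-≡0 {suc a} {suc b} (s≤s p) = χ≤-≡0 p

χ≤-≤1 : ∀ a b → χ≤ a b ≤ 1
χ≤-≤1 zero    b       = ≤-refl
χ≤-≤1 (suc a) zero    = z≤n
χ≤-≤1 (suc a) (suc b) = χ≤-≤1 a b

χ≤-cong : ∀ {a b c d} → (a ≤ b → c ≤ d) → (c ≤ d → a ≤ b) → χ≤ a b ≡ χ≤ c d
χ≤-cong {a} {b} to from with a ≤? b
... | yes a≤b = trans (χ≤-≡1 a≤b) (sym (χ≤-≡1 (to a≤b)))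
... | no  a≰b = trans (χ≤-≡0 (≰⇒> a≰b)) (sym (χ≤-≡0 (≰⇒> (λ c≤d → a≰b (from c≤d)))))

χ≡-refl : ∀ a → χ≡ a a ≡ 1
χ≡-refl zero    = refl
χ≡-refl (suc a) = χ≡-refl a

χ≡-≢ : ∀ {a b} → a ≢ b → χ≡ a b ≡ 0
χ≡-≢ {zero}  {zero}  a≢b = ⊥-elim (a≢b refl)
χ≡-≢ {zero}  {suc b} _   = refl
χ≡-≢ {suc a} {zero}  _   = refl
χ≡-≢ {suc a} {suc b} a≢b = χ≡-≢ (λ a≡b → a≢b (cong suc a≡b))

χ≡≢0⇒≡ : ∀ {a b} → χ≡ a b ≢ 0 → a ≡ b
χ≡≢0⇒≡ {zero}  {zero}  _ = refl
χ≡≢0⇒≡ {zero}  {suc b} h = ⊥-elim (h refl)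
χ≡≢0⇒≡ {suc a} {zero}  h = ⊥-elim (h refl)
χ≡≢0⇒≡ {suc a} {suc b} h = cong suc (χ≡≢0⇒≡ h)

∑< : ℕ → (ℕ → ℕ) → ℕ
∑< zero    f = 0
∑< (suc m) f = f 0 + ∑< m (λ i → f (suc i))

infix 5 ∑<
syntax ∑< m (λ i → e) = ∑[ i < m ] e

∑-cong : ∀ m {f g : ℕ → ℕ} → (∀ i → i < m → f i ≡ g i) → ∑< m f ≡ ∑< m g
∑-cong zero    h = refl
∑-cong (suc m) h = cong₂ _+_ (h 0 z<s) (∑-cong m (λ i i<m → h (suc i) (s≤s i<m)))

∑-mono-≤ : ∀ m {f g : ℕ → ℕ} → (∀ i → i < m → f i ≤ g i) → ∑< m f ≤ ∑< m g
∑-mono-≤ zero    h = z≤n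
∑-mono-≤ (suc m) h = +-mono-≤ (h 0 z<s) (∑-mono-≤ m (λ i i<m → h (suc i) (s≤s i<m)))

∑-zero : ∀ m (f : ℕ → ℕ) → (∀ i → i < m → f i ≡ 0) → ∑< m f ≡ 0
∑-zero zero    f h = refl
∑-zero (suc m) f h rewrite h 0 z<s = ∑-zero m _ (λ i i<m → h (suc i) (s≤s i<m))

∑-ones : ∀ m (f : ℕ → ℕ) → (∀ i → i < m → f i ≡ 1) → ∑< m f ≡ m
∑-ones zero    f h = refl
∑-ones (suc m) f h rewrite h 0 z<s = cong suc (∑-ones m _ (λ i i<m → h (suc i) (s≤s i<m)))

∑-single : ∀ m (f : ℕ → ℕ) q → q < m → (∀ i → i < m → i ≢ q → f i ≡ 0) → ∑< m f ≡ f q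
∑-single (suc m) f zero    _ h =
  trans (cong (f 0 +_) (∑-zero m _ (λ i i<m → h (suc i) (s≤s i<m) (λ ())))) (+-identityʳ _)
∑-single (suc m) f (suc q) (s≤s q<m) h rewrite h 0 z<s (λ ()) =
  ∑-single m _ q q<m (λ i i<m i≢q → h (suc i) (s≤s i<m) (λ e → i≢q (suc-injective e)))

term≤∑ : ∀ m (f : ℕ → ℕ) i → i < m → f i ≤ ∑< m f
term≤∑ (suc m) f zero    _         = m≤m+n _ _
term≤∑ (suc m) f (suc i) (s≤s i<m) = ≤-trans (term≤∑ m _ i i<m) (m≤n+m _ _)

∑≢0⇒term≢0 : ∀ m (f : ℕ → ℕ) → ∑< m f ≢ 0 → ∃ λ i → i < m × f i ≢ 0
∑≢0⇒term≢0 zero    f h = ⊥-elim (h refl)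
∑≢0⇒term≢0 (suc m) f h with f 0 in f0
... | suc _ = 0 , z<s , λ e → 0≢1+n (trans (sym e) f0)
... | zero with ∑≢0⇒term≢0 m (λ i → f (suc i)) h
...   | i , i<m , fi≢0 = suc i , s≤s i<m , fi≢0

∑-distrib-+ : ∀ m (f g : ℕ → ℕ) → ∑[ i < m ] (f i + g i) ≡ ∑< m f + ∑< m g
∑-distrib-+ zero    f g = refl
∑-distrib-+ (suc m) f g rewrite ∑-distrib-+ m (λ i → f (suc i)) (λ i → g (suc i)) =
  CommSemigroupₚ.interchange +-commutativeSemigroup (f 0) (g 0) _ _

∑-distribʳ-* : ∀ m (f : ℕ → ℕ) c → ∑[ i < m ] (f i * c) ≡ ∑< m f * c
∑-distribʳ-* zero    f c = refl
∑-distribʳ-* (suc m) f c =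
  trans (cong (f 0 * c +_) (∑-distribʳ-* m (λ i → f (suc i)) c)) (sym (*-distribʳ-+ c (f 0) _))

∑-comm : ∀ a b (f : ℕ → ℕ → ℕ) →
  ∑[ i < a ] ∑[ j < b ] f i j ≡ ∑[ j < b ] ∑[ i < a ] f i j
∑-comm zero    b f = sym (∑-zero b (λ _ → 0) (λ _ _ → refl))
∑-comm (suc a) b f =
  trans (cong (∑< b (f 0) +_) (∑-comm a b (λ i → f (suc i))))
        (sym (∑-distrib-+ b (f 0) (λ j → ∑[ i < a ] f (suc i) j)))

∑-≤-bound : ∀ m (f : ℕ → ℕ) → (∀ i → f i ≤ 1) → ∑< m f ≤ m
∑-≤-bound zero    f h = z≤n
∑-≤-bound (suc m) f h = +-mono-≤ (h 0) (∑-≤-bound m _ (λ i → h (suc i)))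

∑≡bound⇒ones : ∀ m (f : ℕ → ℕ) → ∑< m f ≡ m → (∀ i → f i ≤ 1) →
  ∀ i → i < m → f i ≡ 1
∑≡bound⇒ones (suc m) f sum≡ h i i<m with f 0 in f0 | h 0
... | zero | _ = ⊥-elim (<-irrefl refl (subst (_≤ m) sum≡ (∑-≤-bound m _ (λ i → h (suc i)))))
... | suc zero | _ with i
...   | zero   = f0
...   | suc i′ = ∑≡bound⇒ones m _ (suc-injective sum≡) (λ i → h (suc i)) i′ (s≤s⁻¹ i<m)
∑≡bound⇒ones (suc m) f sum≡ h i i<m | suc (suc _) | s≤s ()

∑-suffix-ones : ∀ m (f : ℕ → ℕ) q → (∀ i → q ≤ i → i < m → f i ≡ 1) → m ∸ q ≤ ∑< m f
∑-suffix-ones m       f zero    h = ≤-reflexive (sym (∑-ones m f (λ i → h i z≤n)))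
∑-suffix-ones zero    f (suc q) h = z≤n
∑-suffix-ones (suc m) f (suc q) h =
  ≤-trans (∑-suffix-ones m _ q (λ i q≤i i<m → h (suc i) (s≤s q≤i) (s≤s i<m))) (m≤n+m _ _)

∑-prefix-zeros : ∀ m (f : ℕ → ℕ) i → i < m → (∀ a → a ≤ i → f a ≡ 0) → (∀ a → f a ≤ 1) →
  ∑< m f ≤ m ∸ suc i
∑-prefix-zeros (suc m) f zero    _         zeros h rewrite zeros 0 z≤n =
  ∑-≤-bound m _ (λ a → h (suc a))
∑-prefix-zeros (suc m) f (suc i) (s≤s i<m) zeros h rewrite zeros 0 z≤n =
  ∑-prefix-zeros m _ i i<m (λ a a≤i → zeros (suc a) (s≤s a≤i)) (λ a → h (suc a))

∑-truncate : ∀ N M (g : ℕ → ℕ) → M ≤ N → ∑[ i < N ] (χ≤ (suc i) M * g i) ≡ ∑< M g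
∑-truncate N       zero    g _         = ∑-zero N _ (λ _ _ → refl)
∑-truncate (suc N) (suc M) g (s≤s M≤N) =
  cong₂ _+_ (+-identityʳ (g 0)) (∑-truncate N M (λ i → g (suc i)) M≤N)

∑-truncate-≥ : ∀ N M (g : ℕ → ℕ) → N ≤ M → ∑[ i < N ] (χ≤ (suc i) M * g i) ≡ ∑< N g
∑-truncate-≥ zero    M       g _         = refl
∑-truncate-≥ (suc N) (suc M) g (s≤s N≤M) =
  cong₂ _+_ (+-identityʳ (g 0)) (∑-truncate-≥ N M (λ i → g (suc i)) N≤M)

m∸n≤o⇒m≤n+o : ∀ m n {o} → m ∸ n ≤ o → m ≤ n + o
m∸n≤o⇒m≤n+o zero    n       _ = z≤n
m∸n≤o⇒m≤n+o (suc m) zero    p = p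
m∸n≤o⇒m≤n+o (suc m) (suc n) p = s≤s (m∸n≤o⇒m≤n+o m n p)

∑-χ≡-∸ : ∀ N j a → a ≤ N → j ≤ suc N → ∑[ r < j ] χ≡ a (N ∸ r) ≡ χ≤ (suc N ∸ j) a
∑-χ≡-∸ N j a a≤N j≤1+N with suc N ∸ j ≤? a
... | no  lo≰a = trans (∑-zero j _ below) (sym (χ≤-≡0 (≰⇒> lo≰a)))
  where
  below : ∀ r → r < j → χ≡ a (N ∸ r) ≡ 0
  below r r<j = χ≡-≢ (λ a≡N∸r → lo≰a (subst (suc N ∸ j ≤_) (sym a≡N∸r) (∸-monoʳ-≤ (suc N) r<j)))
... | yes lo≤a = begin
  ∑[ r < j ] χ≡ a (N ∸ r)  ≡⟨ ∑-single j _ (N ∸ a) N∸a<j others ⟩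
  χ≡ a (N ∸ (N ∸ a))      ≡⟨ cong (χ≡ a) (m∸[m∸n]≡n a≤N) ⟩
  χ≡ a a                  ≡⟨ χ≡-refl a ⟩
  1                       ≡⟨ χ≤-≡1 lo≤a ⟨
  χ≤ (suc N ∸ j) a        ∎
  where
  open ≡-Reasoning
  N∸a<j : N ∸ a < j
  N∸a<j = subst (_≤ j) (+-∸-assoc 1 a≤N)
    (m≤n+o⇒m∸n≤o (suc N) a (subst (suc N ≤_) (+-comm j a) (m∸n≤o⇒m≤n+o (suc N) j lo≤a)))
  others : ∀ r → r < j → r ≢ N ∸ a → χ≡ a (N ∸ r) ≡ 0
  others r r<j r≢N∸a = χ≡-≢ {a} {N ∸ r} (λ a≡N∸r → r≢N∸a (begin
    r            ≡⟨ m∸[m∸n]≡n (s≤s⁻¹ (≤-trans r<j j≤1+N)) ⟨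
    N ∸ (N ∸ r)  ≡⟨ cong (N ∸_) a≡N∸r ⟨
    N ∸ a        ∎))

χ≤-flip : ∀ N k i → i < N → χ≤ k (N ∸ i) ≡ χ≤ (suc i) (suc N ∸ k)
χ≤-flip N k i i<N = χ≤-cong to from
  where
  to : k ≤ N ∸ i → suc i ≤ suc N ∸ k
  to k≤N∸i = m+n≤o⇒m≤o∸n (suc i)
    (s≤s (subst (_≤ N) (+-comm k i) (m≤o∸n⇒m+n≤o k (<⇒≤ i<N) k≤N∸i)))
  from : suc i ≤ suc N ∸ k → k ≤ N ∸ i
  from i<1+N∸k with k ≤? suc N
  ... | yes k≤1+N = m+n≤o⇒m≤o∸n k
    (subst (_≤ N) (+-comm i k) (s≤s⁻¹ (m≤o∸n⇒m+n≤o (suc i) k≤1+N i<1+N∸k)))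
  ... | no  k≰1+N =
    contradiction (subst (suc i ≤_) (m≤n⇒m∸n≡0 (<⇒≤ (≰⇒> k≰1+N))) i<1+N∸k) λ ()

InRange : (ℕ → ℕ) → ℕ → ℕ → Set
InRange F m N = ∀ i → i < m → 1 ≤ F i × F i ≤ N

InjectiveOn : (ℕ → ℕ) → ℕ → Set
InjectiveOn F m = ∀ i j → i < m → j < m → F i ≡ F j → i ≡ j

occurrences : (ℕ → ℕ) → ℕ → ℕ → ℕ
occurrences F m v = ∑[ i < m ] χ≡ (F i) v

occurrences-≤1 : ∀ F m v → InjectiveOn F m → occurrences F m v ≤ 1
occurrences-≤1 F zero    v inj = z≤n
occurrences-≤1 F (suc m) v inj with F 0 ≟ v
... | yes F0≡v rewrite F0≡v | χ≡-refl v = ≤-reflexive (cong suc (∑-zero m _ others))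
  where
  others : ∀ i → i < m → χ≡ (F (suc i)) v ≡ 0
  others i i<m = χ≡-≢ (λ F[1+i]≡v →
    0≢1+n (inj 0 (suc i) z<s (s≤s i<m) (trans F0≡v (sym F[1+i]≡v))))
... | no  F0≢v rewrite χ≡-≢ F0≢v = occurrences-≤1 (λ i → F (suc i)) m v
  (λ i j i<m j<m e → suc-injective (inj (suc i) (suc j) (s≤s i<m) (s≤s j<m) e))

occurrences-pos : ∀ F m i → i < m → 1 ≤ occurrences F m (F i)
occurrences-pos F m i i<m = subst (_≤ occurrences F m (F i)) (χ≡-refl (F i)) (term≤∑ m _ i i<m)

∑-χ≡-range : ∀ N a → 1 ≤ a → a ≤ N → ∑[ v < N ] χ≡ a (suc v) ≡ 1
∑-χ≡-range N (suc a) _ a<N =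
  trans (∑-single N _ a a<N (λ v _ v≢a → χ≡-≢ (λ e → v≢a (sym (suc-injective e))))) (χ≡-refl a)

∑-occurrences : ∀ F m N → InRange F m N → ∑[ v < N ] occurrences F m (suc v) ≡ m
∑-occurrences F m N range =
  trans (sym (∑-comm m N (λ i v → χ≡ (F i) (suc v))))
        (∑-ones m _ (λ i i<m → ∑-χ≡-range N (F i) (proj₁ (range i i<m)) (proj₂ (range i i<m))))

¬onto-suc : ∀ F n → InRange F n (suc n) →
  ¬ (∀ v → 1 ≤ v → v ≤ suc n → ∃ λ i → i < n × F i ≡ v)
¬onto-suc F n range onto = <-irrefl refl (begin
  suc n                                   ≡⟨ ∑-ones (suc n) (λ _ → 1) (λ _ _ → refl) ⟨
  ∑[ v < suc n ] 1                        ≤⟨ ∑-mono-≤ (suc n) hit ⟩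
  ∑[ v < suc n ] occurrences F n (suc v)  ≡⟨ ∑-occurrences F n (suc n) range ⟩
  n                                       ∎)
  where
  open ≤-Reasoning
  hit : ∀ v → v < suc n → 1 ≤ occurrences F n (suc v)
  hit v v≤n with onto (suc v) (s≤s z≤n) v≤n
  ... | i , i<n , Fi≡1+v = subst (λ w → 1 ≤ occurrences F n w) Fi≡1+v (occurrences-pos F n i i<n)

occurrences-perm : ∀ F N → InRange F N N → InjectiveOn F N →
  ∀ v → v < N → occurrences F N (suc v) ≡ 1
occurrences-perm F N range inj =
  ∑≡bound⇒ones N _ (∑-occurrences F N N range) (λ v → occurrences-≤1 F N (suc v) inj)

perm-surjective : ∀ F N → InRange F N N → InjectiveOn F N →
  ∀ v → 1 ≤ v → v ≤ N → ∃ λ i → i < N × F i ≡ v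
perm-surjective F N range inj (suc v) _ v<N
  with ∑≢0⇒term≢0 N (λ i → χ≡ (F i) (suc v))
         (λ occ≡0 → 0≢1+n (trans (sym occ≡0) (occurrences-perm F N range inj v v<N)))
... | i , i<N , χ≢0 = i , i<N , χ≡≢0⇒≡ χ≢0

∑-reindex-perm : ∀ F N → InRange F N N → InjectiveOn F N → ∀ (h : ℕ → ℕ) →
  ∑[ i < N ] h (F i) ≡ ∑[ v < N ] h (suc v)
∑-reindex-perm F N range inj h = begin
  ∑[ i < N ] h (F i)                                   ≡⟨ ∑-cong N spread ⟩
  ∑[ i < N ] ∑[ v < N ] (χ≡ (F i) (suc v) * h (suc v)) ≡⟨ ∑-comm N N _ ⟩
  ∑[ v < N ] ∑[ i < N ] (χ≡ (F i) (suc v) * h (suc v)) ≡⟨ ∑-cong N collect ⟩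
  ∑[ v < N ] h (suc v)                                 ∎
  where
  open ≡-Reasoning
  spread : ∀ i → i < N → h (F i) ≡ ∑[ v < N ] (χ≡ (F i) (suc v) * h (suc v))
  spread i i<N with F i | range i i<N
  ... | suc a | _ , a<N = sym (begin
    ∑[ v < N ] (χ≡ (suc a) (suc v) * h (suc v))
      ≡⟨ ∑-single N _ a a<N (λ v _ v≢a → cong (_* h (suc v)) (χ≡-≢ (λ e → v≢a (sym e)))) ⟩
    χ≡ a a * h (suc a)  ≡⟨ cong (_* h (suc a)) (χ≡-refl a) ⟩
    h (suc a) + 0       ≡⟨ +-identityʳ _ ⟩
    h (suc a)           ∎)
  collect : ∀ v → v < N → ∑[ i < N ] (χ≡ (F i) (suc v) * h (suc v)) ≡ h (suc v)
  collect v v<N = begin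
    ∑[ i < N ] (χ≡ (F i) (suc v) * h (suc v))
      ≡⟨ ∑-distribʳ-* N _ (h (suc v)) ⟩
    occurrences F N (suc v) * h (suc v)
      ≡⟨ cong (_* h (suc v)) (occurrences-perm F N range inj v v<N) ⟩
    h (suc v) + 0  ≡⟨ +-identityʳ _ ⟩
    h (suc v)      ∎

-- Lists and vectors read as functions on ℕ (with the junk value 0 out of range)

nth : List ℕ → ℕ → ℕ
nth []      _       = 0
nth (a ∷ l) zero    = a
nth (a ∷ l) (suc i) = nth l i

applyUpTo-nth : ∀ l {m} → length l ≡ m → l ≡ applyUpTo (nth l) m
applyUpTo-nth []      refl = refl
applyUpTo-nth (a ∷ l) refl = cong (a ∷_) (applyUpTo-nth l refl)

take-applyUpTo : ∀ (f : ℕ → ℕ) j N → j ≤ N → take j (applyUpTo f N) ≡ applyUpTo f j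
take-applyUpTo f zero    N       _         = refl
take-applyUpTo f (suc j) (suc N) (s≤s j≤N) =
  cong (f 0 ∷_) (take-applyUpTo (λ i → f (suc i)) j N j≤N)

∈⇒nth : ∀ {v l} → v ∈ l → ∃ λ i → i < length l × nth l i ≡ v
∈⇒nth (here v≡a) = 0 , z<s , sym v≡a
∈⇒nth (there v∈l) with ∈⇒nth v∈l
... | i , i<l , e = suc i , s≤s i<l , e

nth∈ : ∀ l i → i < length l → nth l i ∈ l
nth∈ (a ∷ l) zero    _         = here refl
nth∈ (a ∷ l) (suc i) (s≤s i<l) = there (nth∈ l i i<l)

posOf-nth : ∀ l q v → q < length l → nth l q ≡ v → (∀ i → i < q → nth l i ≢ v) →
  posOf v l ≡ suc q
posOf-nth (w ∷ l) zero v _ w≡v _ with v ≟ w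
... | yes _   = refl
... | no  v≢w = ⊥-elim (v≢w (sym w≡v))
posOf-nth (w ∷ l) (suc q) v (s≤s q<l) e earlier with v ≟ w
... | yes v≡w = ⊥-elim (earlier 0 z<s (sym v≡w))
... | no  _ rewrite posOf-nth l q v q<l e (λ i i<q → earlier (suc i) (s≤s i<q)) = refl

col : ∀ {n} → Vec ℕ n → ℕ → ℕ
col x = nth (toList x)

lookup-col : ∀ {n} (x : Vec ℕ n) i → lookup x i ≡ col x (toℕ i)
lookup-col (a Vec.∷ x) Fin.zero    = refl
lookup-col (a Vec.∷ x) (Fin.suc i) = lookup-col x i

col-lookup : ∀ {n} (x : Vec ℕ n) {r} (r<n : r < n) → col x r ≡ lookup x (fromℕ< r<n)
col-lookup x r<n = trans (cong (col x) (sym (Finₚ.toℕ-fromℕ< r<n))) (sym (lookup-col x (fromℕ< r<n)))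

col-injective : ∀ {n} (x y : Vec ℕ n) → (∀ r → r < n → col x r ≡ col y r) → x ≡ y
col-injective x y same = begin
  x                    ≡⟨ Vecₚ.tabulate∘lookup x ⟨
  tabulate (lookup x)  ≡⟨ Vecₚ.tabulate-cong lookup-same ⟩
  tabulate (lookup y)  ≡⟨ Vecₚ.tabulate∘lookup y ⟩
  y                    ∎
  where
  open ≡-Reasoning
  lookup-same : ∀ i → lookup x i ≡ lookup y i
  lookup-same i = trans (lookup-col x i) (trans (same (toℕ i) (Finₚ.toℕ<n i)) (sym (lookup-col y i)))

toList-applyUpTo : ∀ {n} (x : Vec ℕ n) → toList x ≡ applyUpTo (col x) n
toList-applyUpTo x = applyUpTo-nth (toList x) (Vecₚ.length-toList x)

<-length-toList : ∀ {n} (x : Vec ℕ n) {i} → i < n → i < length (toList x)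
<-length-toList x = subst (_ <_) (sym (Vecₚ.length-toList x))

col-∷ʳ-< : ∀ {n} (x : Vec ℕ n) a {i} → i < n → col (x ∷ʳ a) i ≡ col x i
col-∷ʳ-< (b Vec.∷ x) a {zero}  _         = refl
col-∷ʳ-< (b Vec.∷ x) a {suc i} (s≤s i<n) = col-∷ʳ-< x a i<n

col-∷ʳ-n : ∀ {n} (x : Vec ℕ n) a → col (x ∷ʳ a) n ≡ a
col-∷ʳ-n Vec.[]      a = refl
col-∷ʳ-n (b Vec.∷ x) a = col-∷ʳ-n x a

-- Counting entries ≥ k, and comparing sorted lists

count≥ : ℕ → List ℕ → ℕ
count≥ k l = length (filter (k ≤?_) l)

count≥-accept : ∀ {k a} l → k ≤ a → count≥ k (a ∷ l) ≡ suc (count≥ k l)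
count≥-accept l k≤a = cong length (Listₚ.filter-accept (_ ≤?_) k≤a)

count≥-reject : ∀ {k a} l → k ≰ a → count≥ k (a ∷ l) ≡ count≥ k l
count≥-reject l k≰a = cong length (Listₚ.filter-reject (_ ≤?_) k≰a)

count≥-∷ : ∀ k a l → count≥ k (a ∷ l) ≡ χ≤ k a + count≥ k l
count≥-∷ k a l with k ≤? a
... | yes k≤a rewrite χ≤-≡1 k≤a = count≥-accept l k≤a
... | no  k≰a rewrite χ≤-≡0 (≰⇒> k≰a) = count≥-reject l k≰a

count≥-applyUpTo : ∀ k (f : ℕ → ℕ) j → count≥ k (applyUpTo f j) ≡ ∑[ i < j ] χ≤ k (f i)
count≥-applyUpTo k f zero    = refl
count≥-applyUpTo k f (suc j) =
  trans (count≥-∷ k (f 0) _) (cong (χ≤ k (f 0) +_) (count≥-applyUpTo k (λ i → f (suc i)) j))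

count≥-≤-length : ∀ k l → count≥ k l ≤ length l
count≥-≤-length k = Listₚ.length-filter (k ≤?_)

count≥-↭ : ∀ k {a b} → a ↭ b → count≥ k a ≡ count≥ k b
count≥-↭ k a↭b = Permₚ.↭-length (Permₚ.filter-↭ (k ≤?_) a↭b)

count≥-sorted : ∀ {k a l} → Linked _≤_ (a ∷ l) → k ≤ a → count≥ k (a ∷ l) ≡ length (a ∷ l)
count≥-sorted sorted k≤a =
  cong length (Listₚ.filter-all (_ ≤?_) (Linked⇒All ≤-trans k≤a sorted))

pointwise⇒count≥ : ∀ {s t} → Pointwise _≤_ s t → ∀ k → count≥ k s ≤ count≥ k t
pointwise⇒count≥ [] k = z≤n
pointwise⇒count≥ {a ∷ s} {b ∷ t} (a≤b ∷ s≤t) k with k ≤? a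
... | yes k≤a rewrite count≥-accept s k≤a | count≥-accept t (≤-trans k≤a a≤b) =
  s≤s (pointwise⇒count≥ s≤t k)
... | no  k≰a rewrite count≥-reject s k≰a | count≥-∷ k b t =
  ≤-trans (pointwise⇒count≥ s≤t k) (m≤n+m _ _)

count≥⇒pointwise : ∀ {s t} → Linked _≤_ s → Linked _≤_ t → length s ≡ length t →
  (∀ k → count≥ k s ≤ count≥ k t) → Pointwise _≤_ s t
count≥⇒pointwise {[]}    {[]}    _  _  _   _ = []
count≥⇒pointwise {a ∷ s} {b ∷ t} ss st len counts =
  a≤b ∷ count≥⇒pointwise (Linked.tail ss) (Linked.tail st) (suc-injective len) tail-counts
  where
  a≤b : a ≤ b
  a≤b with a ≤? b
  ... | yes a≤b = a≤b
  ... | no  a≰b = ⊥-elim (<-irrefl refl (begin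
    suc (length s)    ≡⟨ count≥-sorted ss ≤-refl ⟨
    count≥ a (a ∷ s)  ≤⟨ counts a ⟩
    count≥ a (b ∷ t)  ≡⟨ count≥-reject t a≰b ⟩
    count≥ a t        ≤⟨ count≥-≤-length a t ⟩
    length t          ≡⟨ suc-injective len ⟨
    length s          ∎))
    where open ≤-Reasoning
  tail-counts : ∀ k → count≥ k s ≤ count≥ k t
  tail-counts k with k ≤? a | k ≤? b
  ... | yes k≤a | _ =
    s≤s⁻¹ (subst₂ _≤_ (count≥-accept s k≤a) (count≥-accept t (≤-trans k≤a a≤b)) (counts k))
  ... | no k≰a | yes k≤b = begin
    count≥ k s  ≤⟨ count≥-≤-length k s ⟩
    length s    ≡⟨ suc-injective len ⟩
    length t    ≡⟨ suc-injective (trans (sym (count≥-sorted st k≤b)) (count≥-accept t k≤b)) ⟩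
    count≥ k t  ∎
    where open ≤-Reasoning
  ... | no k≰a | no k≰b = subst₂ _≤_ (count≥-reject s k≰a) (count≥-reject t k≰b) (counts k)

sort-pointwise⇔count≥ : ∀ a b → length a ≡ length b →
  Pointwise _≤_ (sortℕ a) (sortℕ b) ⇔ (∀ k → count≥ k a ≤ count≥ k b)
sort-pointwise⇔count≥ a b len = mk⇔
  (λ sa≤sb k → subst₂ _≤_ (count≥-↭ k (sort-↭ a)) (count≥-↭ k (sort-↭ b)) (pointwise⇒count≥ sa≤sb k))
  (λ counts → count≥⇒pointwise (sort-↗ a) (sort-↗ b) sorted-length
     (λ k → subst₂ _≤_ (sym (count≥-↭ k (sort-↭ a))) (sym (count≥-↭ k (sort-↭ b))) (counts k)))
  where
  sort-↭ : ∀ l → sortℕ l ↭ l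
  sort-↭ = InsertionSortₚ.sort-↭ ≤-decTotalOrder
  sort-↗ : ∀ l → Linked _≤_ (sortℕ l)
  sort-↗ = InsertionSortₚ.sort-↗ ≤-decTotalOrder
  sorted-length : length (sortℕ a) ≡ length (sortℕ b)
  sorted-length = trans (Permₚ.↭-length (sort-↭ a)) (trans len (sym (Permₚ.↭-length (sort-↭ b))))

-- Rows are 0-indexed and columns 1-indexed: col x i is the column of the rook in row i + 1.
record IsPlacement {n : ℕ} (x : Vec ℕ n) : Set where
  constructor mkPlacement
  field
    range     : InRange (col x) n (suc n)
    injective : InjectiveOn (col x) n

col⁺ : ∀ {n} → Vec ℕ n → ℕ → ℕ
col⁺ x = nth (extend x)

extend-toList : ∀ {n} (x : Vec ℕ n) → extend x ≡ toList (x ∷ʳ missing x)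
extend-toList x = sym (Vecₚ.toList-∷ʳ (missing x) x)

col⁺-< : ∀ {n} (x : Vec ℕ n) i → i < n → col⁺ x i ≡ col x i
col⁺-< x i i<n = trans (cong (λ l → nth l i) (extend-toList x)) (col-∷ʳ-< x (missing x) i<n)

col⁺-n : ∀ {n} (x : Vec ℕ n) → col⁺ x n ≡ missing x
col⁺-n {n} x = trans (cong (λ l → nth l n) (extend-toList x)) (col-∷ʳ-n x (missing x))

length-extend : ∀ {n} (x : Vec ℕ n) → length (extend x) ≡ suc n
length-extend x = trans (cong length (extend-toList x)) (Vecₚ.length-toList (x ∷ʳ missing x))

missing-spec : ∀ {n} (x : Vec ℕ n) →
  (∀ v → 1 ≤ v → v ≤ suc n → v ∈ toList x) ⊎
  (1 ≤ missing x × missing x ≤ suc n × missing x ∉ toList x)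
missing-spec {n} x with filter (λ v → ¬? (any? (v ≟_) (toList x))) (applyUpTo suc (suc n)) in eq
... | [] = inj₁ covered
  where
  covered : ∀ v → 1 ≤ v → v ≤ suc n → v ∈ toList x
  covered (suc v) _ v<1+n with any? (suc v ≟_) (toList x)
  ... | yes v∈x = v∈x
  ... | no  v∉x = contradiction (subst (suc v ∈_) eq
    (∈-filter⁺ (λ v → ¬? (any? (v ≟_) (toList x))) (∈-applyUpTo⁺ suc v<1+n) v∉x)) λ ()
... | v ∷ _ with ∈-filter⁻ (λ v → ¬? (any? (v ≟_) (toList x))) (subst (v ∈_) (sym eq) (here refl))
...   | v∈range , v∉x with ∈-applyUpTo⁻ suc v∈range
...     | i , i<1+n , refl = inj₂ (s≤s z≤n , i<1+n , v∉x)

module _ {n : ℕ} {x : Vec ℕ n} (px : IsPlacement x) where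

  missing-free : 1 ≤ missing x × missing x ≤ suc n × (∀ i → i < n → col x i ≢ missing x)
  missing-free with missing-spec x
  ... | inj₁ covered = ⊥-elim (¬onto-suc (col x) n (IsPlacement.range px) onto)
    where
    onto : ∀ v → 1 ≤ v → v ≤ suc n → ∃ λ i → i < n × col x i ≡ v
    onto v 1≤v v≤1+n with ∈⇒nth (covered v 1≤v v≤1+n)
    ... | i , i<l , e = i , subst (i <_) (Vecₚ.length-toList x) i<l , e
  ... | inj₂ (1≤m , m≤1+n , m∉x) = 1≤m , m≤1+n ,
    λ i i<n e → m∉x (subst (_∈ toList x) e (nth∈ (toList x) i (<-length-toList x i<n)))

  col⁺-<≢col⁺-n : ∀ i → i < n → col⁺ x i ≢ col⁺ x n
  col⁺-<≢col⁺-n i i<n e =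
    proj₂ (proj₂ missing-free) i i<n (trans (sym (col⁺-< x i i<n)) (trans e (col⁺-n x)))

  col⁺-range : InRange (col⁺ x) (suc n) (suc n)
  col⁺-range i i<1+n with m<1+n⇒m<n∨m≡n i<1+n
  ... | inj₁ i<n  rewrite col⁺-< x i i<n = IsPlacement.range px i i<n
  ... | inj₂ refl rewrite col⁺-n x = proj₁ missing-free , proj₁ (proj₂ missing-free)

  col⁺-injective : InjectiveOn (col⁺ x) (suc n)
  col⁺-injective i j i<1+n j<1+n e with m<1+n⇒m<n∨m≡n i<1+n | m<1+n⇒m<n∨m≡n j<1+n
  ... | inj₁ i<n  | inj₁ j<n  = IsPlacement.injective px i j i<n j<n
    (trans (sym (col⁺-< x i i<n)) (trans e (col⁺-< x j j<n)))
  ... | inj₁ i<n  | inj₂ refl = ⊥-elim (col⁺-<≢col⁺-n i i<n e)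
  ... | inj₂ refl | inj₁ j<n  = ⊥-elim (col⁺-<≢col⁺-n j j<n (sym e))
  ... | inj₂ refl | inj₂ refl = refl

  col⁺-surjective : ∀ v → 1 ≤ v → v ≤ suc n → ∃ λ q → q < suc n × col⁺ x q ≡ v
  col⁺-surjective = perm-surjective (col⁺ x) (suc n) col⁺-range col⁺-injective

  missing-unique : ∀ v → 1 ≤ v → v ≤ suc n → (∀ i → i < n → col x i ≢ v) → missing x ≡ v
  missing-unique v 1≤v v≤1+n unused with col⁺-surjective v 1≤v v≤1+n
  ... | q , q<1+n , e with m<1+n⇒m<n∨m≡n q<1+n
  ...   | inj₁ q<n  = ⊥-elim (unused q q<n (trans (sym (col⁺-< x q q<n)) e))
  ...   | inj₂ refl = trans (sym (col⁺-n x)) e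

  posOf-extend : ∀ v → 1 ≤ v → v ≤ suc n →
    ∃ λ q → q < suc n × col⁺ x q ≡ v × posOf v (extend x) ≡ suc q
  posOf-extend v 1≤v v≤1+n with col⁺-surjective v 1≤v v≤1+n
  ... | q , q<1+n , e = q , q<1+n , e ,
    posOf-nth (extend x) q v (subst (q <_) (sym (length-extend x)) q<1+n) e
      (λ i i<q e′ → <-irrefl (col⁺-injective i q (<-trans i<q q<1+n) q<1+n (trans e′ (sym e))) i<q)

-- The reflection φ

φ-col : ∀ {n} (x : Vec ℕ n) r → r < n → col (φ x) r ≡ suc (suc n) ∸ posOf (suc n ∸ r) (extend x)
φ-col {n} x r r<n = begin
  col (φ x) r
    ≡⟨ col-lookup (φ x) r<n ⟩
  lookup (φ x) (fromℕ< r<n)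
    ≡⟨ Vecₚ.lookup∘tabulate _ (fromℕ< r<n) ⟩
  (n + 2) ∸ posOf (n + 1 ∸ toℕ (fromℕ< r<n)) (extend x)
    ≡⟨ cong₂ (λ a b → a ∸ posOf (b ∸ toℕ (fromℕ< r<n)) (extend x)) (+-comm n 2) (+-comm n 1) ⟩
  suc (suc n) ∸ posOf (suc n ∸ toℕ (fromℕ< r<n)) (extend x)
    ≡⟨ cong (λ t → suc (suc n) ∸ posOf (suc n ∸ t) (extend x)) (Finₚ.toℕ-fromℕ< r<n) ⟩
  suc (suc n) ∸ posOf (suc n ∸ r) (extend x)
    ∎
  where open ≡-Reasoning

φ-row : ∀ {n} {x : Vec ℕ n} → IsPlacement x → ∀ r → r < n →
  ∃ λ q → q < suc n × col⁺ x q ≡ suc n ∸ r × col (φ x) r ≡ suc n ∸ q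
φ-row {n} {x} px r r<n
  with posOf-extend px (suc n ∸ r) (m<n⇒0<n∸m (m<n⇒m<1+n r<n)) (m∸n≤m _ r)
... | q , q<1+n , e , pos = q , q<1+n , e , trans (φ-col x r r<n) (cong (suc (suc n) ∸_) pos)

φ-placement : ∀ {n} {x : Vec ℕ n} → IsPlacement x → IsPlacement (φ x)
φ-placement {n} {x} px = mkPlacement range injective
  where
  range : InRange (col (φ x)) n (suc n)
  range r r<n with φ-row px r r<n
  ... | q , q<1+n , _ , e = subst (λ c → 1 ≤ c × c ≤ suc n) (sym e) (m<n⇒0<n∸m q<1+n , m∸n≤m _ q)
  injective : InjectiveOn (col (φ x)) n
  injective r r′ r<n r′<n eq with φ-row px r r<n | φ-row px r′ r′<n
  ... | q , q<1+n , e , f | q′ , q′<1+n , e′ , f′ =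
    ∸-cancelˡ-≡ (m<n⇒m≤1+n r<n) (m<n⇒m≤1+n r′<n) (trans (sym e) (trans (cong (col⁺ x) q≡q′) e′))
    where
    q≡q′ : q ≡ q′
    q≡q′ = ∸-cancelˡ-≡ (<⇒≤ q<1+n) (<⇒≤ q′<1+n) (trans (sym f) (trans eq f′))

col⁺-φ : ∀ {n} {x : Vec ℕ n} → IsPlacement x → ∀ r → r < suc n →
  ∃ λ q → q < suc n × col⁺ x q ≡ suc n ∸ r × col⁺ (φ x) r ≡ suc n ∸ q
col⁺-φ {n} {x} px r r<1+n with m<1+n⇒m<n∨m≡n r<1+n
... | inj₁ r<n with φ-row px r r<n
...   | q , q<1+n , e , f = q , q<1+n , e , trans (col⁺-< (φ x) r r<n) f
col⁺-φ {n} {x} px r _ | inj₂ refl with col⁺-surjective px 1 ≤-refl (s≤s z≤n)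
... | q₁ , q₁<1+n , e₁ = q₁ , q₁<1+n , e₁′ , trans (col⁺-n (φ x))
  (missing-unique (φ-placement px) (suc n ∸ q₁) (m<n⇒0<n∸m q₁<1+n) (m∸n≤m _ q₁) unused)
  where
  e₁′ : col⁺ x q₁ ≡ suc n ∸ n
  e₁′ = trans e₁ (sym (m+n∸n≡m 1 n))
  unused : ∀ i → i < n → col (φ x) i ≢ suc n ∸ q₁
  unused i i<n eq with φ-row px i i<n
  ... | q , q<1+n , f , f′ = <-irrefl i≡n i<n
    where
    q≡q₁ : q ≡ q₁
    q≡q₁ = ∸-cancelˡ-≡ (<⇒≤ q<1+n) (<⇒≤ q₁<1+n) (trans (sym f′) eq)
    i≡n : i ≡ n
    i≡n = ∸-cancelˡ-≡ (m<n⇒m≤1+n i<n) (n≤1+n n) (trans (sym f) (trans (cong (col⁺ x) q≡q₁) e₁′))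

φ-involutive : ∀ {n} {x : Vec ℕ n} → IsPlacement x → φ (φ x) ≡ x
φ-involutive {n} {x} px = col-injective (φ (φ x)) x same
  where
  same : ∀ r → r < n → col (φ (φ x)) r ≡ col x r
  same r r<n with φ-row (φ-placement px) r r<n
  ... | p , p<1+n , e , e′ with col⁺-φ px p p<1+n
  ...   | q , q<1+n , f , f′ = begin
    col (φ (φ x)) r  ≡⟨ e′ ⟩
    suc n ∸ p        ≡⟨ f ⟨
    col⁺ x q         ≡⟨ cong (col⁺ x) q≡r ⟩
    col⁺ x r         ≡⟨ col⁺-< x r r<n ⟩
    col x r          ∎
    where
    open ≡-Reasoning
    q≡r : q ≡ r
    q≡r = ∸-cancelˡ-≡ (<⇒≤ q<1+n) (m<n⇒m≤1+n r<n) (trans (sym f′) e)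

φ-injective : ∀ {n} {x y : Vec ℕ n} → IsPlacement x → IsPlacement y → φ x ≡ φ y → x ≡ y
φ-injective {x = x} {y} px py φx≡φy = begin
  x        ≡⟨ φ-involutive px ⟨
  φ (φ x)  ≡⟨ cong φ φx≡φy ⟩
  φ (φ y)  ≡⟨ φ-involutive py ⟩
  y        ∎
  where open ≡-Reasoning

-- Rectangle counts and the rook order

-- The number of rooks of the extension in the first j rows and in columns ≥ k.
rect : ∀ {n} → Vec ℕ n → ℕ → ℕ → ℕ
rect {n} x j k = ∑[ i < suc n ] (χ≤ (suc i) j * χ≤ k (col⁺ x i))

_≤rect_ : ∀ {n} → Vec ℕ n → Vec ℕ n → Set
_≤rect_ {n} x y = ∀ j → j ≤ n → ∀ k → rect x j k ≤ rect y j k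

rect-prefix : ∀ {n} (x : Vec ℕ n) {j} k → j ≤ suc n → rect x j k ≡ ∑[ i < j ] χ≤ k (col⁺ x i)
rect-prefix {n} x {j} k = ∑-truncate (suc n) j (λ i → χ≤ k (col⁺ x i))

rect-all : ∀ {n} {x : Vec ℕ n} → IsPlacement x → ∀ {j} k → suc n ≤ j →
  rect x j k ≡ ∑[ v < suc n ] χ≤ k (suc v)
rect-all {n} {x} px {j} k 1+n≤j =
  trans (∑-truncate-≥ (suc n) j (λ i → χ≤ k (col⁺ x i)) 1+n≤j)
        (∑-reindex-perm (col⁺ x) (suc n) (col⁺-range px) (col⁺-injective px) (χ≤ k))

χ≤-col⁺-φ : ∀ {n} {x : Vec ℕ n} → IsPlacement x → ∀ k r → r < suc n →
  χ≤ k (col⁺ (φ x) r) ≡ ∑[ i < suc n ] (χ≡ (col⁺ x i) (suc n ∸ r) * χ≤ k (suc n ∸ i))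
χ≤-col⁺-φ {n} {x} px k r r<1+n with col⁺-φ px r r<1+n
... | q , q<1+n , e , f = sym (begin
  ∑[ i < suc n ] (χ≡ (col⁺ x i) (suc n ∸ r) * χ≤ k (suc n ∸ i))
    ≡⟨ ∑-single (suc n) _ q q<1+n others ⟩
  χ≡ (col⁺ x q) (suc n ∸ r) * χ≤ k (suc n ∸ q)
    ≡⟨ cong (λ c → χ≡ c (suc n ∸ r) * χ≤ k (suc n ∸ q)) e ⟩
  χ≡ (suc n ∸ r) (suc n ∸ r) * χ≤ k (suc n ∸ q)
    ≡⟨ cong (_* χ≤ k (suc n ∸ q)) (χ≡-refl (suc n ∸ r)) ⟩
  χ≤ k (suc n ∸ q) + 0
    ≡⟨ +-identityʳ _ ⟩
  χ≤ k (suc n ∸ q)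
    ≡⟨ cong (χ≤ k) f ⟨
  χ≤ k (col⁺ (φ x) r)
    ∎)
  where
  open ≡-Reasoning
  others : ∀ i → i < suc n → i ≢ q → χ≡ (col⁺ x i) (suc n ∸ r) * χ≤ k (suc n ∸ i) ≡ 0
  others i i<1+n i≢q = cong (_* χ≤ k (suc n ∸ i))
    (χ≡-≢ (λ e′ → i≢q (col⁺-injective px i q i<1+n q<1+n (trans e′ (sym e)))))

rect-φ : ∀ {n} {x : Vec ℕ n} → IsPlacement x → ∀ {j} k → j ≤ n →
  rect (φ x) j k ≡ rect x (suc (suc n) ∸ k) (suc (suc n) ∸ j)
rect-φ {n} {x} px {j} k j≤n = begin
  rect (φ x) j k
    ≡⟨ rect-prefix (φ x) k (m≤n⇒m≤1+n j≤n) ⟩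
  ∑[ r < j ] χ≤ k (col⁺ (φ x) r)
    ≡⟨ ∑-cong j (λ r r<j → χ≤-col⁺-φ px k r (<-≤-trans r<j (m≤n⇒m≤1+n j≤n))) ⟩
  ∑[ r < j ] ∑[ i < suc n ] (χ≡ (col⁺ x i) (suc n ∸ r) * χ≤ k (suc n ∸ i))
    ≡⟨ ∑-comm j (suc n) (λ r i → χ≡ (col⁺ x i) (suc n ∸ r) * χ≤ k (suc n ∸ i)) ⟩
  ∑[ i < suc n ] ∑[ r < j ] (χ≡ (col⁺ x i) (suc n ∸ r) * χ≤ k (suc n ∸ i))
    ≡⟨ ∑-cong (suc n) row ⟩
  rect x (suc (suc n) ∸ k) (suc (suc n) ∸ j)
    ∎
  where
  open ≡-Reasoning
  row : ∀ i → i < suc n →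
    ∑[ r < j ] (χ≡ (col⁺ x i) (suc n ∸ r) * χ≤ k (suc n ∸ i)) ≡
    χ≤ (suc i) (suc (suc n) ∸ k) * χ≤ (suc (suc n) ∸ j) (col⁺ x i)
  row i i<1+n = begin
    ∑[ r < j ] (χ≡ (col⁺ x i) (suc n ∸ r) * χ≤ k (suc n ∸ i))
      ≡⟨ ∑-distribʳ-* j _ (χ≤ k (suc n ∸ i)) ⟩
    (∑[ r < j ] χ≡ (col⁺ x i) (suc n ∸ r)) * χ≤ k (suc n ∸ i)
      ≡⟨ cong₂ _*_ (∑-χ≡-∸ (suc n) j (col⁺ x i) (proj₂ (col⁺-range px i i<1+n)) j≤2+n)
                   (χ≤-flip (suc n) k i i<1+n) ⟩
    χ≤ (suc (suc n) ∸ j) (col⁺ x i) * χ≤ (suc i) (suc (suc n) ∸ k)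
      ≡⟨ *-comm (χ≤ (suc (suc n) ∸ j) (col⁺ x i)) _ ⟩
    χ≤ (suc i) (suc (suc n) ∸ k) * χ≤ (suc (suc n) ∸ j) (col⁺ x i)
      ∎
    where
    j≤2+n : j ≤ suc (suc n)
    j≤2+n = m≤n⇒m≤1+n (m≤n⇒m≤1+n j≤n)

φ-mono-≤rect : ∀ {n} {x y : Vec ℕ n} → IsPlacement x → IsPlacement y → x ≤rect y → φ x ≤rect φ y
φ-mono-≤rect {n} {x} {y} px py x≤y j j≤n k with suc (suc n) ∸ k ≤? n
... | yes 2+n∸k≤n = subst₂ _≤_ (sym (rect-φ px k j≤n)) (sym (rect-φ py k j≤n))
  (x≤y (suc (suc n) ∸ k) 2+n∸k≤n (suc (suc n) ∸ j))
... | no  2+n∸k≰n = ≤-reflexive (begin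
  rect (φ x) j k               ≡⟨ rect-φ px k j≤n ⟩
  rect x M K                   ≡⟨ rect-all px K (≰⇒> 2+n∸k≰n) ⟩
  ∑[ v < suc n ] χ≤ K (suc v)  ≡⟨ rect-all py K (≰⇒> 2+n∸k≰n) ⟨
  rect y M K                   ≡⟨ rect-φ py k j≤n ⟨
  rect (φ y) j k               ∎)
  where
  open ≡-Reasoning
  M K : ℕ
  M = suc (suc n) ∸ k
  K = suc (suc n) ∸ j

take-toList : ∀ {n} (x : Vec ℕ n) {j} → j ≤ n → take j (toList x) ≡ applyUpTo (col x) j
take-toList {n} x {j} j≤n = trans (cong (take j) (toList-applyUpTo x)) (take-applyUpTo (col x) j n j≤n)

length-take-toList : ∀ {n} (x : Vec ℕ n) {j} → j ≤ n → length (take j (toList x)) ≡ j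
length-take-toList x {j} j≤n =
  trans (cong length (take-toList x j≤n)) (Listₚ.length-applyUpTo (col x) j)

count≥-take : ∀ {n} (x : Vec ℕ n) {j} → j ≤ n → ∀ k → count≥ k (take j (toList x)) ≡ rect x j k
count≥-take x {j} j≤n k = begin
  count≥ k (take j (toList x))    ≡⟨ cong (count≥ k) (take-toList x j≤n) ⟩
  count≥ k (applyUpTo (col x) j)  ≡⟨ count≥-applyUpTo k (col x) j ⟩
  ∑[ i < j ] χ≤ k (col x i)       ≡⟨ ∑-cong j (λ i i<j → cong (χ≤ k) (col⁺-< x i (<-≤-trans i<j j≤n))) ⟨
  ∑[ i < j ] χ≤ k (col⁺ x i)      ≡⟨ rect-prefix x k (m≤n⇒m≤1+n j≤n) ⟨
  rect x j k                      ∎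
  where open ≡-Reasoning

SortedPrefix≤ : ∀ {n} → Vec ℕ n → Vec ℕ n → ℕ → Set
SortedPrefix≤ x y j = Pointwise _≤_ (sortℕ (take j (toList x))) (sortℕ (take j (toList y)))

sortedPrefix≤⇔rect : ∀ {n} (x y : Vec ℕ n) {j} → j ≤ n →
  SortedPrefix≤ x y j ⇔ (∀ k → rect x j k ≤ rect y j k)
sortedPrefix≤⇔rect x y {j} j≤n = mk⇔
  (λ x≤y k → subst₂ _≤_ (count≥-take x j≤n k) (count≥-take y j≤n k) (Equivalence.to prefix⇔ x≤y k))
  (λ x≤y → Equivalence.from prefix⇔
    (λ k → subst₂ _≤_ (sym (count≥-take x j≤n k)) (sym (count≥-take y j≤n k)) (x≤y k)))
  where
  prefix⇔ : SortedPrefix≤ x y j ⇔ (∀ k → count≥ k (take j (toList x)) ≤ count≥ k (take j (toList y)))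
  prefix⇔ = sort-pointwise⇔count≥ (take j (toList x)) (take j (toList y))
    (trans (length-take-toList x j≤n) (sym (length-take-toList y j≤n)))

≤R⇔≤rect : ∀ {n} (x y : Vec ℕ n) → x ≤R y ⇔ x ≤rect y
≤R⇔≤rect {n} x y = mk⇔
  (λ x≤y j j≤n → Equivalence.to (sortedPrefix≤⇔rect x y j≤n)
     (subst (SortedPrefix≤ x y) (Finₚ.toℕ-fromℕ< (s≤s j≤n)) (x≤y (fromℕ< (s≤s j≤n)))))
  (λ x≤y f → let j≤n = s≤s⁻¹ (Finₚ.toℕ<n f) in
     Equivalence.from (sortedPrefix≤⇔rect x y j≤n) (x≤y (toℕ f) j≤n))

φ-mono-≤R : ∀ {n} {x y : Vec ℕ n} → IsPlacement x → IsPlacement y → x ≤R y → φ x ≤R φ y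
φ-mono-≤R {x = x} {y} px py x≤y =
  Equivalence.from (≤R⇔≤rect (φ x) (φ y)) (φ-mono-≤rect px py (Equivalence.to (≤R⇔≤rect x y) x≤y))

φ-≤R⇔ : ∀ {n} {x y : Vec ℕ n} → IsPlacement x → IsPlacement y → x ≤R y ⇔ φ x ≤R φ y
φ-≤R⇔ px py = mk⇔ (φ-mono-≤R px py) (λ φx≤φy →
  subst₂ _≤R_ (φ-involutive px) (φ-involutive py) (φ-mono-≤R (φ-placement px) (φ-placement py) φx≤φy))

-- Ferrers boards

la⁺ : ∀ {n} → Vec ℕ n → ℕ → ℕ
la⁺ {n} la = col (la ∷ʳ suc n)

conj-col : ∀ {n} (la : Vec ℕ n) r → r < n →
  col (conj la) r ≡ ∑[ a < suc n ] χ≤ (suc n ∸ r) (la⁺ la a)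
conj-col {n} la r r<n = begin
  col (conj la) r
    ≡⟨ col-lookup (conj la) r<n ⟩
  lookup (conj la) (fromℕ< r<n)
    ≡⟨ Vecₚ.lookup∘tabulate _ (fromℕ< r<n) ⟩
  count≥ (n + 1 ∸ toℕ (fromℕ< r<n)) (toList (la ∷ʳ suc n))
    ≡⟨ cong₂ (λ m t → count≥ (m ∸ t) (toList (la ∷ʳ suc n))) (+-comm n 1) (Finₚ.toℕ-fromℕ< r<n) ⟩
  count≥ (suc n ∸ r) (toList (la ∷ʳ suc n))
    ≡⟨ cong (count≥ (suc n ∸ r)) (toList-applyUpTo (la ∷ʳ suc n)) ⟩
  count≥ (suc n ∸ r) (applyUpTo (la⁺ la) (suc n))
    ≡⟨ count≥-applyUpTo (suc n ∸ r) (la⁺ la) (suc n) ⟩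
  ∑[ a < suc n ] χ≤ (suc n ∸ r) (la⁺ la a)
    ∎
  where open ≡-Reasoning

conj-col-bounded : ∀ {n} (la : Vec ℕ n) r → r < n → col (conj la) r ≤ suc n
conj-col-bounded {n} la r r<n = subst (_≤ suc n) (sym (conj-col la r r<n))
  (∑-≤-bound (suc n) _ (λ a → χ≤-≤1 (suc n ∸ r) (la⁺ la a)))

module _ {n : ℕ} (la x : Vec ℕ n) where

  rookPlacement⇒placement : (∀ i → i < n → col la i ≤ suc n) → IsRookPlacement la x → IsPlacement x
  rookPlacement⇒placement la≤ (bounds , inj) = mkPlacement range injective
    where
    range : InRange (col x) n (suc n)
    range i i<n rewrite col-lookup x i<n = proj₁ (bounds (fromℕ< i<n)) ,
      ≤-trans (proj₂ (bounds (fromℕ< i<n))) (subst (_≤ suc n) (col-lookup la i<n) (la≤ i i<n))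
    injective : InjectiveOn (col x) n
    injective i j i<n j<n e = begin
      i                 ≡⟨ Finₚ.toℕ-fromℕ< i<n ⟨
      toℕ (fromℕ< i<n)  ≡⟨ cong toℕ (inj _ _ (trans (sym (col-lookup x i<n)) (trans e (col-lookup x j<n)))) ⟩
      toℕ (fromℕ< j<n)  ≡⟨ Finₚ.toℕ-fromℕ< j<n ⟩
      j                 ∎
      where open ≡-Reasoning

  rookPlacement⇒fits : IsRookPlacement la x → ∀ i → i < n → col x i ≤ col la i
  rookPlacement⇒fits (bounds , _) i i<n rewrite col-lookup x i<n | col-lookup la i<n =
    proj₂ (bounds (fromℕ< i<n))

  placement⇒rookPlacement : IsPlacement x → (∀ i → i < n → col x i ≤ col la i) → IsRookPlacement la x
  placement⇒rookPlacement (mkPlacement range inj) fits = bounds , injective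
    where
    bounds : ∀ i → 1 ≤ lookup x i × lookup x i ≤ lookup la i
    bounds i = subst (1 ≤_) (sym (lookup-col x i)) (proj₁ (range (toℕ i) (Finₚ.toℕ<n i))) ,
               subst₂ _≤_ (sym (lookup-col x i)) (sym (lookup-col la i)) (fits (toℕ i) (Finₚ.toℕ<n i))
    injective : ∀ i j → lookup x i ≡ lookup x j → i ≡ j
    injective i j e = Finₚ.toℕ-injective (inj (toℕ i) (toℕ j) (Finₚ.toℕ<n i) (Finₚ.toℕ<n j)
      (trans (sym (lookup-col x i)) (trans e (lookup-col x j))))

module Shape {n : ℕ} (la : Vec ℕ n) (la-mono : WeaklyIncreasing la)
             (la-pos : ∀ i → 1 ≤ lookup la i) (la-bounded : ∀ i → lookup la i ≤ suc n) where

  col-la-mono : ∀ {a b} → a ≤ b → b < n → col la a ≤ col la b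
  col-la-mono {a} {b} a≤b b<n = subst₂ _≤_ (sym (col-lookup la a<n)) (sym (col-lookup la b<n))
    (la-mono (fromℕ< a<n) (fromℕ< b<n)
      (subst₂ _≤_ (sym (Finₚ.toℕ-fromℕ< a<n)) (sym (Finₚ.toℕ-fromℕ< b<n)) a≤b))
    where
    a<n : a < n
    a<n = ≤-<-trans a≤b b<n

  col-la-bounded : ∀ i → i < n → col la i ≤ suc n
  col-la-bounded i i<n = subst (_≤ suc n) (sym (col-lookup la i<n)) (la-bounded (fromℕ< i<n))

  la⁺-mono : ∀ {a b} → a ≤ b → b < suc n → la⁺ la a ≤ la⁺ la b
  la⁺-mono {a} {b} a≤b b<1+n with m<1+n⇒m<n∨m≡n b<1+n
  ... | inj₁ b<n = subst₂ _≤_ (sym (col-∷ʳ-< la (suc n) (≤-<-trans a≤b b<n)))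
                             (sym (col-∷ʳ-< la (suc n) b<n)) (col-la-mono a≤b b<n)
  ... | inj₂ refl with m≤n⇒m<n∨m≡n a≤b
  ...   | inj₁ a<n  = subst₂ _≤_ (sym (col-∷ʳ-< la (suc n) a<n))
                               (sym (col-∷ʳ-n la (suc n))) (col-la-bounded a a<n)
  ...   | inj₂ refl = ≤-refl

  placement : ∀ x → IsRookPlacement la x → IsPlacement x
  placement x = rookPlacement⇒placement la x col-la-bounded

  placement-conj : ∀ y → IsRookPlacement (conj la) y → IsPlacement y
  placement-conj y = rookPlacement⇒placement (conj la) y (conj-col-bounded la)

  col⁺≤la⁺ : ∀ x → IsRookPlacement la x → ∀ q → q < suc n → col⁺ x q ≤ la⁺ la q
  col⁺≤la⁺ x rx q q<1+n with m<1+n⇒m<n∨m≡n q<1+n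
  ... | inj₁ q<n  = subst₂ _≤_ (sym (col⁺-< x q q<n)) (sym (col-∷ʳ-< la (suc n) q<n))
                             (rookPlacement⇒fits la x rx q q<n)
  ... | inj₂ refl = subst (col⁺ x q ≤_) (sym (col-∷ʳ-n la (suc n)))
                          (proj₂ (col⁺-range (placement x rx) q q<1+n))

  conj-col-≥ : ∀ {q r} → q < suc n → suc n ∸ r ≤ la⁺ la q → r < n → suc n ∸ q ≤ col (conj la) r
  conj-col-≥ {q} {r} q<1+n lo≤la⁺q r<n = subst (suc n ∸ q ≤_) (sym (conj-col la r r<n))
    (∑-suffix-ones (suc n) _ q (λ a q≤a a<1+n → χ≤-≡1 (≤-trans lo≤la⁺q (la⁺-mono q≤a a<1+n))))

  conj-col-≤ : ∀ {q i} → i < n → col la i < suc n ∸ q → q < n → col (conj la) q ≤ n ∸ i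
  conj-col-≤ {q} {i} i<n la-i<lo q<n = subst (_≤ n ∸ i) (sym (conj-col la q q<n))
    (∑-prefix-zeros (suc n) _ i (m<n⇒m<1+n i<n) below (λ a → χ≤-≤1 (suc n ∸ q) (la⁺ la a)))
    where
    below : ∀ a → a ≤ i → χ≤ (suc n ∸ q) (la⁺ la a) ≡ 0
    below a a≤i = χ≤-≡0 (≤-<-trans (subst (_≤ col la i) (sym (col-∷ʳ-< la (suc n) (≤-<-trans a≤i i<n)))
                                          (col-la-mono a≤i i<n)) la-i<lo)

  φ-fits-conj : ∀ x → IsRookPlacement la x → IsRookPlacement (conj la) (φ x)
  φ-fits-conj x rx = placement⇒rookPlacement (conj la) (φ x) (φ-placement (placement x rx)) fits
    where
    fits : ∀ r → r < n → col (φ x) r ≤ col (conj la) r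
    fits r r<n with φ-row (placement x rx) r r<n
    ... | q , q<1+n , e , f = subst (_≤ col (conj la) r) (sym f)
      (conj-col-≥ q<1+n (subst (_≤ la⁺ la q) e (col⁺≤la⁺ x rx q q<1+n)) r<n)

  reflected-fits : ∀ y → IsRookPlacement (conj la) y →
    ∀ {i q} → i < n → q < suc n → col⁺ y q ≡ suc n ∸ i → suc n ∸ q ≤ col la i
  reflected-fits y ry {i} {q} i<n q<1+n e with m<1+n⇒m<n∨m≡n q<1+n
  ... | inj₂ refl = subst₂ _≤_ (sym (m+n∸n≡m 1 q)) (sym (col-lookup la i<n)) (la-pos (fromℕ< i<n))
  ... | inj₁ q<n with suc n ∸ q ≤? col la i
  ...   | yes fits = fits
  ...   | no  too-big = contradiction (subst (_≤ n ∸ i) (+-∸-assoc 1 (<⇒≤ i<n)) (begin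
    suc n ∸ i        ≡⟨ e ⟨
    col⁺ y q         ≡⟨ col⁺-< y q q<n ⟩
    col y q          ≤⟨ rookPlacement⇒fits (conj la) y ry q q<n ⟩
    col (conj la) q  ≤⟨ conj-col-≤ i<n (≰⇒> too-big) q<n ⟩
    n ∸ i            ∎)) (n≮n (n ∸ i))
    where open ≤-Reasoning

  φ-fits : ∀ y → IsRookPlacement (conj la) y → IsRookPlacement la (φ y)
  φ-fits y ry = placement⇒rookPlacement la (φ y) (φ-placement (placement-conj y ry)) fits
    where
    fits : ∀ i → i < n → col (φ y) i ≤ col la i
    fits i i<n with φ-row (placement-conj y ry) i i<n
    ... | q , q<1+n , e , f = subst (_≤ col la i) (sym f) (reflected-fits y ry i<n q<1+n e)

bounded-by-top : ∀ {n} (la : Vec ℕ n) → WeaklyIncreasing la →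
  (∀ i → suc (toℕ i) ≡ n → lookup la i ≡ suc n) → ∀ i → lookup la i ≤ suc n
bounded-by-top {suc m} la la-mono top i =
  subst (lookup la i ≤_) (top (fromℕ m) (cong suc (Finₚ.toℕ-fromℕ m)))
    (la-mono i (fromℕ m) (subst (toℕ i ≤_) (sym (Finₚ.toℕ-fromℕ m)) (Finₚ.toℕ≤pred[n] i)))

mainTheorem3 : (n : ℕ) (la : Vec ℕ n) →
    WeaklyIncreasing la →
    (∀ (i : Fin n) → suc (toℕ i) ≤ lookup la i) →
    1 ≤ n →
    (∀ (i : Fin n) → suc (toℕ i) ≡ n → lookup la i ≡ suc n) →
    (∀ x → IsRookPlacement la x → IsRookPlacement (conj la) (φ x)) ×
    (∀ x y → IsRookPlacement la x → IsRookPlacement la y → φ x ≡ φ y → x ≡ y) ×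
    (∀ y → IsRookPlacement (conj la) y → ∃ λ x → IsRookPlacement la x × φ x ≡ y) ×
    (∀ x y → IsRookPlacement la x → IsRookPlacement la y → (x ≤R y ⇔ φ x ≤R φ y))
mainTheorem3 n la la-mono la≥row _ top =
    φ-fits-conj
  , (λ x y rx ry → φ-injective (placement x rx) (placement y ry))
  , (λ y ry → φ y , φ-fits y ry , φ-involutive (placement-conj y ry))
  , (λ x y rx ry → φ-≤R⇔ (placement x rx) (placement y ry))
  where
  open Shape la la-mono (λ i → ≤-trans (s≤s z≤n) (la≥row i)) (bounded-by-top la la-mono top)
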